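{- We have $\psi(y\mathfrak{H})\subset y\mathfrak{H}x$.
   Context: Let $\mathfrak{H}=\mathbb{Q}\langle x,y\rangle$, $z_k=yx^{k-1}$, $\mathfrak{H}^1=\mathbb{Q}+y\mathfrak{H}$. The harmonic product $\ast$ on $\mathfrak{H}^1$ is given by $1\ast u=u\ast1=u$, $z_ku\ast z_lv=z_k(u\ast z_lv)+z_l(z_ku\ast v)+z_{k+l}(u\ast v)$. The shuffle product $\mathbin{\sqcup\!\sqcup}$ on $\mathfrak{H}$ is given by $1\mathbin{\sqcup\!\sqcup} w=w\mathbin{\sqcup\!\sqcup} 1=w$, $au\mathbin{\sqcup\!\sqcup} bv=a(u\mathbin{\sqcup\!\sqcup} bv)+b(au\mathbin{\sqcup\!\sqcup} v)$ for letters $a,b$. For $m\ge0$, $\sigma_m\colon\mathfrak{H}^1\to\mathfrak{H}^1$ is linear with $\sigma_m(1)=\delta_{m,0}$, $\sigma_m(yw)=y(w\mathbin{\sqcup\!\sqcup} x^m)$. $S_1$ is the automorphism of $\mathfrak{H}$ with $S_1(x)=x$, $S_1(y)=x+y$; $S\colon\mathfrak{H}^1\to\mathfrak{H}^1$ is linear with $S(1)=1$, $S(yw)=yS_1(w)$; $d$ is the automorphism of $\mathfrak{H}$ with $d(x)=x$, $d(y)=-y$; $\tilde S:=S\circ d$. The linear map $\psi\colon y\mathfrak{H}\to y\mathfrak{H}$ is $\psi(z_{k_1}\cdots z_{k_r})=\sum_{i=0}^{r-1}z_{k_1}\cdots z_{k_i}\ast\tilde S(\sigma_1(z_{k_r}\cdots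 z_{k_{i+1}}))$. -}

module Defs where

open import Data.Nat using (ℕ; zero; suc; _+_)
open import Data.Rational using (ℚ; 0ℚ; 1ℚ; -_; _*_) renaming (_+_ to _+ℚ_)
open import Data.List using (List; []; _∷_; _++_; map; concatMap; take; drop; reverse; length; replicate)
open import Data.List.Properties using (≡-dec)
open import Data.Product using (_×_; _,_; ∃)
open import Relation.Nullary using (yes; no)
open import Relation.Binary.PropositionalEquality using (_≡_)
import Data.Nat.Properties as ℕP

data Letter : Set where
  x y : Letter

Word : Set
Word = List Letter

-- Elements of 𝔥 as (non-normalised) formal ℚ-linear combinations of words
Poly : Set
Poly = List (ℚ × Word)

-- Words of 𝔥¹ written in the letters z_k = y x^(k-1).
-- Convention: the natural number n encodes z_(n+1).  Every word of 𝔥¹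
-- (i.e. 1 or a word beginning with y) is uniquely such a list.
ZWord : Set
ZWord = List ℕ

PolyZ : Set
PolyZ = List (ℚ × ZWord)

fromZ : ZWord → Word
fromZ []       = []
fromZ (n ∷ ns) = y ∷ (replicate n x ++ fromZ ns)

-- parse a letter word of the form y·w (given w, with n x's already read
-- after the current y) into a z-word; total and inverse to fromZ on y𝔥
parseY : ℕ → Word → ZWord
parseY n []      = n ∷ []
parseY n (x ∷ w) = parseY (suc n) w
parseY n (y ∷ w) = n ∷ parseY 0 w

scale : ℚ → Poly → Poly
scale q = map (λ { (c , w) → (q * c , w) })

scaleZ : ℚ → PolyZ → PolyZ
scaleZ q = map (λ { (c , w) → (q * c , w) })

lmul : Letter → Poly → Poly
lmul a = map (λ { (c , w) → (c , a ∷ w) })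

lmulZ : ℕ → PolyZ → PolyZ
lmulZ n = map (λ { (c , w) → (c , n ∷ w) })

sh : Word → Word → Poly
sh []      v       = (1ℚ , v) ∷ []
sh (a ∷ u) []      = (1ℚ , a ∷ u) ∷ []
sh (a ∷ u) (b ∷ v) = lmul a (sh u (b ∷ v)) ++ lmul b (sh (a ∷ u) v)

-- harmonic (stuffle) product of z-words:
-- z_k u * z_l v = z_k (u * z_l v) + z_l (z_k u * v) + z_(k+l) (u * v)
-- with z_(n+1), z_(m+1) ↦ z_(n+m+2) encoded as suc (n + m)
st : ZWord → ZWord → PolyZ
st []      v       = (1ℚ , v) ∷ []
st (n ∷ u) []      = (1ℚ , n ∷ u) ∷ []
st (n ∷ u) (m ∷ v) = lmulZ n (st u (m ∷ v)) ++ lmulZ m (st (n ∷ u) v)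
                     ++ lmulZ (suc (n + m)) (st u v)

stP : ZWord → PolyZ → PolyZ
stP u = concatMap (λ { (c , v) → scaleZ c (st u v) })

-- σ_m on z-words: σ_m(1) = δ_{m,0}, σ_m(y w) = y (w ш x^m)
σ : ℕ → ZWord → PolyZ
σ zero    []       = (1ℚ , []) ∷ []
σ (suc m) []       = []
σ m       (n ∷ ns) =
  map (λ { (c , w) → (c , parseY 0 w) }) (sh (replicate n x ++ fromZ ns) (replicate m x))

-- d : x ↦ x, y ↦ -y on words
sign : Word → ℚ
sign []      = 1ℚ
sign (x ∷ w) = sign w
sign (y ∷ w) = - sign w

S₁ : Word → Poly
S₁ []      = (1ℚ , []) ∷ []
S₁ (x ∷ w) = lmul x (S₁ w)
S₁ (y ∷ w) = lmul x (S₁ w) ++ lmul y (S₁ w)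

-- S : 1 ↦ 1, y w ↦ y S_1(w), on z-words
S : ZWord → PolyZ
S []       = (1ℚ , []) ∷ []
S (n ∷ ns) = map (λ { (c , w) → (c , parseY 0 w) }) (S₁ (replicate n x ++ fromZ ns))

-- S̃ = S ∘ d on z-words, and its linear extension
S̃ : ZWord → PolyZ
S̃ w = scaleZ (sign (fromZ w)) (S w)

S̃P : PolyZ → PolyZ
S̃P = concatMap (λ { (c , w) → scaleZ c (S̃ w) })

-- ψ(z_{k_1}⋯z_{k_r}) = Σ_{i=0}^{r-1} z_{k_1}⋯z_{k_i} ∗ S̃(σ_1(z_{k_r}⋯z_{k_{i+1}}))
ψ-sum : ZWord → ℕ → PolyZ
ψ-sum w zero    = []
ψ-sum w (suc i) = ψ-sum w i ++ stP (take i w) (S̃P (σ 1 (reverse (drop i w))))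

ψ : ZWord → PolyZ
ψ w = ψ-sum w (length w)

-- linear extension of ψ to y𝔥; a term (c , n , ns) stands for c · z_(n+1) ns
ψP : List (ℚ × ℕ × ZWord) → PolyZ
ψP = concatMap (λ { (c , n , ns) → scaleZ c (ψ (n ∷ ns)) })

coeff : PolyZ → ZWord → ℚ
coeff []             v = 0ℚ
coeff ((c , w) ∷ p)  v with ≡-dec ℕP._≟_ w v
... | yes _ = c +ℚ coeff p v
... | no  _ = coeff p v

InYHx : Word → Set
InYHx w = ∃ λ u → w ≡ y ∷ (u ++ x ∷ [])

-- A z-word lies outside y𝔥x exactly when it is 1 or ends in z₁.  So it suffices
-- that ψ(w) has no constant term and that ψ(w) is killed by every functional ρ g,
-- where ρ g (u z₁) = g u and ρ g vanishes on the words not ending in z₁.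
-- The constant term vanishes because every summand of ψ(w) is a ∗-product with an
-- element of y𝔥.  For the second part, ρ is a derivation of ∗, commutes with σ₁
-- and anticommutes with S̃.  Hence ρ g applied to the i-th summand of ψ(w) is
-- C i − C (i+1), where C i = ρ (a ↦ g (a ∗ S̃σ₁(z_{k_r}⋯z_{k_{i+1}}))) (z_{k_1}⋯z_{k_i}),
-- and the sum telescopes to C 0 − C r, where C 0 = 0 as ρ vanishes on 1 and
-- C r = 0 as σ₁(1) = 0.

module Submission where

open import Defs
open import Data.Bool using (Bool; true; false; if_then_else_)
open import Data.Empty using (⊥-elim)
open import Data.List using (List; []; _∷_; _++_; _∷ʳ_; map; concatMap; take; drop; reverse; length; replicate)
import Data.List.Properties as List
open import Data.List.Reverse using (reverseView; []; _∶_∶ʳ_)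
open import Data.Nat using (ℕ; zero; suc; _≤_; s≤s) renaming (_+_ to _+ℕ_)
import Data.Nat.Properties as ℕ
open import Data.Product using (_×_; _,_; proj₁; proj₂; Σ-syntax)
open import Data.Rational using (ℚ; 0ℚ; 1ℚ; _+_; _*_; -_)
import Data.Rational.Properties as ℚ
open import Data.Rational.Solver using (module +-*-Solver)
open +-*-Solver using (solve; _:+_; _:*_; :-_; _:=_; con)
open import Relation.Nullary using (yes; no; does)
open import Relation.Binary.PropositionalEquality using (_≡_; _≢_; refl; sym; trans; cong; cong₂; module ≡-Reasoning)
open ≡-Reasoning

eval : {A : Set} → (A → ℚ) → List (ℚ × A) → ℚ
eval g []            = 0ℚ
eval g ((c , w) ∷ P) = c * g w + eval g P

module _ {A : Set} where

  eval-cong : {g h : A → ℚ} (P : List (ℚ × A)) → (∀ t → g t ≡ h t) → eval g P ≡ eval h P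
  eval-cong []            g≗h = refl
  eval-cong ((c , w) ∷ P) g≗h = cong₂ (λ u v → c * u + v) (g≗h w) (eval-cong P g≗h)

  eval-++ : (g : A → ℚ) (P Q : List (ℚ × A)) → eval g (P ++ Q) ≡ eval g P + eval g Q
  eval-++ g []            Q = sym (ℚ.+-identityˡ _)
  eval-++ g ((c , w) ∷ P) Q = begin
    c * g w + eval g (P ++ Q)       ≡⟨ cong (c * g w +_) (eval-++ g P Q) ⟩
    c * g w + (eval g P + eval g Q) ≡⟨ ℚ.+-assoc (c * g w) (eval g P) (eval g Q) ⟨
    c * g w + eval g P + eval g Q   ∎

  eval-zero : (P : List (ℚ × A)) → eval (λ _ → 0ℚ) P ≡ 0ℚ
  eval-zero []            = refl
  eval-zero ((c , w) ∷ P) rewrite eval-zero P | ℚ.*-zeroʳ c = refl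

  eval-+ : (F G : A → ℚ) (P : List (ℚ × A)) → eval (λ t → F t + G t) P ≡ eval F P + eval G P
  eval-+ F G []            = refl
  eval-+ F G ((c , w) ∷ P) rewrite eval-+ F G P =
    solve 5 (λ c a b u v → c :* (a :+ b) :+ (u :+ v) := (c :* a :+ u) :+ (c :* b :+ v)) refl
      c (F w) (G w) (eval F P) (eval G P)

  eval-neg : (F : A → ℚ) (P : List (ℚ × A)) → eval (λ t → - F t) P ≡ - eval F P
  eval-neg F []            = refl
  eval-neg F ((c , w) ∷ P) rewrite eval-neg F P =
    solve 3 (λ c a u → c :* (:- a) :+ (:- u) := :- (c :* a :+ u)) refl c (F w) (eval F P)

  eval-map : {B : Set} (g : B → ℚ) (h : A → B) (f : ℚ × A → ℚ × B) →
             (∀ c w → f (c , w) ≡ (c , h w)) → ∀ P → eval g (map f P) ≡ eval (λ w → g (h w)) P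
  eval-map g h f f≡ []            = refl
  eval-map g h f f≡ ((c , w) ∷ P) rewrite f≡ c w = cong (c * g (h w) +_) (eval-map g h f f≡ P)

eval-lmulZ : (g : ZWord → ℚ) (n : ℕ) (P : PolyZ) → eval g (lmulZ n P) ≡ eval (λ t → g (n ∷ t)) P
eval-lmulZ g n = eval-map g (n ∷_) _ (λ _ _ → refl)

eval-lmul : (g : Word → ℚ) (a : Letter) (P : Poly) → eval g (lmul a P) ≡ eval (λ t → g (a ∷ t)) P
eval-lmul g a = eval-map g (a ∷_) _ (λ _ _ → refl)

eval-scaleZ : (g : ZWord → ℚ) (c : ℚ) (P : PolyZ) → eval g (scaleZ c P) ≡ c * eval g P
eval-scaleZ g c []            = sym (ℚ.*-zeroʳ c)
eval-scaleZ g c ((d , w) ∷ P) rewrite eval-scaleZ g c P =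
  solve 4 (λ c d a u → (c :* d) :* a :+ c :* u := c :* (d :* a :+ u)) refl c d (g w) (eval g P)

eval-concatMap : {A : Set} (g : ZWord → ℚ) (F : A → PolyZ) (f : ℚ × A → PolyZ) →
                 (∀ c w → f (c , w) ≡ scaleZ c (F w)) →
                 ∀ P → eval g (concatMap f P) ≡ eval (λ w → eval g (F w)) P
eval-concatMap g F f f≡ []            = refl
eval-concatMap g F f f≡ ((c , w) ∷ P) rewrite f≡ c w = begin
  eval g (scaleZ c (F w) ++ concatMap f P)            ≡⟨ eval-++ g (scaleZ c (F w)) (concatMap f P) ⟩
  eval g (scaleZ c (F w)) + eval g (concatMap f P)    ≡⟨ cong₂ _+_ (eval-scaleZ g c (F w)) (eval-concatMap g F f f≡ P) ⟩
  c * eval g (F w) + eval (λ w → eval g (F w)) P      ∎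

NilSupported : {A : Set} → (List A → ℚ) → Set
NilSupported h = ∀ a t → h (a ∷ t) ≡ 0ℚ

eval-nilSupported-∷ : {A : Set} {h : List A → ℚ} → NilSupported h →
                      ∀ a (P : List (ℚ × List A)) → eval (λ t → h (a ∷ t)) P ≡ 0ℚ
eval-nilSupported-∷ h₀ a P = trans (eval-cong P (h₀ a)) (eval-zero P)

-- Transpose of right multiplication by a letter

module _ {A : Set} (e : A → Bool) where

  ρ : (List A → ℚ) → List A → ℚ
  ρ g []          = 0ℚ
  ρ g (a ∷ [])    = if e a then g [] else 0ℚ
  ρ g (a ∷ b ∷ t) = ρ (λ s → g (a ∷ s)) (b ∷ t)

  -- the part of ρ g (a ∷ t) in which a is the removed final letter
  final : A → List A → (List A → ℚ) → ℚ
  final a []      g = if e a then g [] else 0ℚ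
  final a (_ ∷ _) g = 0ℚ

  ρ-∷ : (g : List A → ℚ) (a : A) (t : List A) → ρ g (a ∷ t) ≡ ρ (λ s → g (a ∷ s)) t + final a t g
  ρ-∷ g a []      = sym (ℚ.+-identityˡ _)
  ρ-∷ g a (b ∷ t) = sym (ℚ.+-identityʳ _)

  ρ-∷ʳ : (g : List A → ℚ) (u : List A) (a : A) → ρ g (u ∷ʳ a) ≡ (if e a then g u else 0ℚ)
  ρ-∷ʳ g []          a = refl
  ρ-∷ʳ g (b ∷ [])    a = refl
  ρ-∷ʳ g (b ∷ c ∷ u) a = ρ-∷ʳ (λ s → g (b ∷ s)) (c ∷ u) a

  ρ-cong : {g h : List A → ℚ} → (∀ t → g t ≡ h t) → ∀ u → ρ g u ≡ ρ h u
  ρ-cong g≗h []          = refl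
  ρ-cong g≗h (a ∷ [])    = cong (if e a then_else 0ℚ) (g≗h [])
  ρ-cong g≗h (a ∷ b ∷ t) = ρ-cong (λ s → g≗h (a ∷ s)) (b ∷ t)

  ρ-zero : ∀ u → ρ (λ _ → 0ℚ) u ≡ 0ℚ
  ρ-zero []          = refl
  ρ-zero (a ∷ [])    with e a
  ... | true  = refl
  ... | false = refl
  ρ-zero (a ∷ b ∷ t) = ρ-zero (b ∷ t)

  ρ-scale : (c : ℚ) (g : List A → ℚ) → ∀ u → ρ (λ t → c * g t) u ≡ c * ρ g u
  ρ-scale c g []          = sym (ℚ.*-zeroʳ c)
  ρ-scale c g (a ∷ [])    with e a
  ... | true  = refl
  ... | false = sym (ℚ.*-zeroʳ c)
  ρ-scale c g (a ∷ b ∷ t) = ρ-scale c (λ s → g (a ∷ s)) (b ∷ t)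

  ρ-+ : (g h : List A → ℚ) → ∀ u → ρ (λ t → g t + h t) u ≡ ρ g u + ρ h u
  ρ-+ g h []          = refl
  ρ-+ g h (a ∷ [])    with e a
  ... | true  = refl
  ... | false = refl
  ρ-+ g h (a ∷ b ∷ t) = ρ-+ (λ s → g (a ∷ s)) (λ s → h (a ∷ s)) (b ∷ t)

  ρ-neg : (g : List A → ℚ) → ∀ u → ρ (λ t → - g t) u ≡ - ρ g u
  ρ-neg g []          = refl
  ρ-neg g (a ∷ [])    with e a
  ... | true  = refl
  ... | false = refl
  ρ-neg g (a ∷ b ∷ t) = ρ-neg (λ s → g (a ∷ s)) (b ∷ t)

  ρ-eval : {B : Set} (H : List A → B → ℚ) (T : List (ℚ × B)) → ∀ u →
           ρ (λ s → eval (H s) T) u ≡ eval (λ t → ρ (λ s → H s t) u) T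
  ρ-eval H []            u = ρ-zero u
  ρ-eval H ((c , t) ∷ T) u = begin
    ρ (λ s → c * H s t + eval (H s) T) u              ≡⟨ ρ-+ (λ s → c * H s t) (λ s → eval (H s) T) u ⟩
    ρ (λ s → c * H s t) u + ρ (λ s → eval (H s) T) u  ≡⟨ cong₂ _+_ (ρ-scale c (λ s → H s t) u) (ρ-eval H T u) ⟩
    c * ρ (λ s → H s t) u + eval (λ t → ρ (λ s → H s t) u) T ∎

  eval-ρ-∷ : (g : List A → ℚ) (a : A) (P : List (ℚ × List A)) →
             eval (λ t → ρ g (a ∷ t)) P ≡ eval (ρ (λ s → g (a ∷ s))) P + eval (λ t → final a t g) P
  eval-ρ-∷ g a P = trans (eval-cong P (ρ-∷ g a)) (eval-+ _ _ P)

  final-cong : {g h : List A → ℚ} → g [] ≡ h [] → ∀ a t → final a t g ≡ final a t h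
  final-cong g≡h a []      = cong (if e a then_else 0ℚ) g≡h
  final-cong g≡h a (_ ∷ _) = refl

  final-unselected : ∀ a → e a ≡ false → ∀ t (g : List A → ℚ) → final a t g ≡ 0ℚ
  final-unselected a ea≡false []      g rewrite ea≡false = refl
  final-unselected a ea≡false (_ ∷ _) g = refl

isZ₁ : ℕ → Bool
isZ₁ zero    = true
isZ₁ (suc _) = false

ρᶻ : (ZWord → ℚ) → ZWord → ℚ
ρᶻ = ρ isZ₁

st-[]ʳ : ∀ a → st a [] ≡ (1ℚ , a) ∷ []
st-[]ʳ []      = refl
st-[]ʳ (n ∷ a) = refl

eval-1 : {A : Set} (g : A → ℚ) (a : A) → eval g ((1ℚ , a) ∷ []) ≡ g a
eval-1 g a = solve 1 (λ u → con 1ℚ :* u :+ con 0ℚ := u) refl (g a)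

eval-st-∷ : ∀ (g : ZWord → ℚ) n a m b → eval g (st (n ∷ a) (m ∷ b)) ≡
            eval (λ t → g (n ∷ t)) (st a (m ∷ b)) +
            (eval (λ t → g (m ∷ t)) (st (n ∷ a) b) + eval (λ t → g (suc (n +ℕ m) ∷ t)) (st a b))
eval-st-∷ g n a m b = begin
  eval g (lmulZ n (st a (m ∷ b)) ++ lmulZ m (st (n ∷ a) b) ++ lmulZ k (st a b))
    ≡⟨ eval-++ g (lmulZ n (st a (m ∷ b))) (lmulZ m (st (n ∷ a) b) ++ lmulZ k (st a b)) ⟩
  eval g (lmulZ n (st a (m ∷ b))) + eval g (lmulZ m (st (n ∷ a) b) ++ lmulZ k (st a b))
    ≡⟨ cong (eval g (lmulZ n (st a (m ∷ b))) +_) (eval-++ g (lmulZ m (st (n ∷ a) b)) (lmulZ k (st a b))) ⟩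
  eval g (lmulZ n (st a (m ∷ b))) + (eval g (lmulZ m (st (n ∷ a) b)) + eval g (lmulZ k (st a b)))
    ≡⟨ cong₂ _+_ (eval-lmulZ g n (st a (m ∷ b)))
         (cong₂ _+_ (eval-lmulZ g m (st (n ∷ a) b)) (eval-lmulZ g k (st a b))) ⟩
  eval (λ t → g (n ∷ t)) (st a (m ∷ b)) + (eval (λ t → g (m ∷ t)) (st (n ∷ a) b) + eval (λ t → g (k ∷ t)) (st a b)) ∎
  where k = suc (n +ℕ m)

eval-st-nonemptyʳ : {h : ZWord → ℚ} → NilSupported h → ∀ a m b → eval h (st a (m ∷ b)) ≡ 0ℚ
eval-st-nonemptyʳ {h} h₀ []      m b rewrite h₀ m b = refl
eval-st-nonemptyʳ {h} h₀ (n ∷ a) m b = begin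
  eval h (st (n ∷ a) (m ∷ b))  ≡⟨ eval-st-∷ h n a m b ⟩
  _                            ≡⟨ cong₂ _+_ (vanish n (st a (m ∷ b)))
                                    (cong₂ _+_ (vanish m (st (n ∷ a) b)) (vanish (suc (n +ℕ m)) (st a b))) ⟩
  0ℚ + (0ℚ + 0ℚ)               ≡⟨⟩
  0ℚ                           ∎
  where vanish = eval-nilSupported-∷ {h = h} h₀

eval-st-nonemptyˡ : {h : ZWord → ℚ} → NilSupported h → ∀ n a b → eval h (st (n ∷ a) b) ≡ 0ℚ
eval-st-nonemptyˡ {h} h₀ n a []      rewrite h₀ n a = refl
eval-st-nonemptyˡ {h} h₀ n a (m ∷ b) = eval-st-nonemptyʳ h₀ (n ∷ a) m b

-- A final z₁ of a word in a ∗ b is the final letter of a or of b: the merged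
-- letters z_(k+l) are never z₁.
Leibniz : (ZWord → ℚ) → ZWord → ZWord → Set
Leibniz g a b = eval (ρᶻ g) (st a b) ≡ ρᶻ (λ a′ → eval g (st a′ b)) a + ρᶻ (λ b′ → eval g (st a b′)) b

ρᶻ-derivation : ∀ g a b → Leibniz g a b
ρᶻ-derivation g [] b = begin
  eval (ρᶻ g) ((1ℚ , b) ∷ [])                 ≡⟨ eval-1 (ρᶻ g) b ⟩
  ρᶻ g b                                      ≡⟨ ρ-cong isZ₁ (λ t → eval-1 g t) b ⟨
  ρᶻ (λ b′ → eval g ((1ℚ , b′) ∷ [])) b       ≡⟨ ℚ.+-identityˡ _ ⟨
  0ℚ + ρᶻ (λ b′ → eval g (st [] b′)) b        ∎
ρᶻ-derivation g (n ∷ a) [] = begin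
  eval (ρᶻ g) ((1ℚ , n ∷ a) ∷ [])             ≡⟨ eval-1 (ρᶻ g) (n ∷ a) ⟩
  ρᶻ g (n ∷ a)                                ≡⟨ ρ-cong isZ₁ (λ t → trans (cong (eval g) (st-[]ʳ t)) (eval-1 g t)) (n ∷ a) ⟨
  ρᶻ (λ a′ → eval g (st a′ [])) (n ∷ a)       ≡⟨ ℚ.+-identityʳ _ ⟨
  ρᶻ (λ a′ → eval g (st a′ [])) (n ∷ a) + 0ℚ  ∎
ρᶻ-derivation g (n ∷ a) (m ∷ b) = begin
  eval (ρᶻ g) (st (n ∷ a) (m ∷ b))
    ≡⟨ eval-st-∷ (ρᶻ g) n a m b ⟩
  eval (λ t → ρᶻ g (n ∷ t)) (st a (m ∷ b)) +
  (eval (λ t → ρᶻ g (m ∷ t)) (st (n ∷ a) b) + eval (λ t → ρᶻ g (k ∷ t)) (st a b))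
    ≡⟨ cong₂ _+_ (first-n (ρᶻ-derivation gₙ a (m ∷ b)))
                  (cong₂ _+_ (first-m (ρᶻ-derivation gₘ (n ∷ a) b)) (first-k (ρᶻ-derivation gₖ a b))) ⟩
  ((A₁ + (B₁ + Eᵇ)) + 0ℚ) + (((A₂ + Eᵃ) + B₂) + 0ℚ + ((A₃ + B₃) + 0ℚ))
    ≡⟨ solve 8 (λ a₁ a₂ a₃ b₁ b₂ b₃ i j →
         ((a₁ :+ (b₁ :+ j)) :+ con 0ℚ) :+ (((a₂ :+ i) :+ b₂) :+ con 0ℚ :+ ((a₃ :+ b₃) :+ con 0ℚ)) :=
         ((a₁ :+ (a₂ :+ a₃)) :+ i) :+ ((b₁ :+ (b₂ :+ b₃)) :+ j)) refl A₁ A₂ A₃ B₁ B₂ B₃ Eᵃ Eᵇ ⟩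
  ((A₁ + (A₂ + A₃)) + Eᵃ) + ((B₁ + (B₂ + B₃)) + Eᵇ)
    ≡⟨ cong₂ _+_ left right ⟨
  ρᶻ (λ a′ → eval g (st a′ (m ∷ b))) (n ∷ a) + ρᶻ (λ b′ → eval g (st (n ∷ a) b′)) (m ∷ b) ∎
  where
  k  = suc (n +ℕ m)
  gₙ = λ t → g (n ∷ t)
  gₘ = λ t → g (m ∷ t)
  gₖ = λ t → g (k ∷ t)
  A₁ = ρᶻ (λ s → eval gₙ (st s (m ∷ b))) a
  A₂ = ρᶻ (λ s → eval gₘ (st (n ∷ s) b)) a
  A₃ = ρᶻ (λ s → eval gₖ (st s b)) a
  B₁ = ρᶻ (λ s → eval gₙ (st a (m ∷ s))) b
  B₂ = ρᶻ (λ s → eval gₘ (st (n ∷ a) s)) b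
  B₃ = ρᶻ (λ s → eval gₖ (st a s)) b
  Eᵃ = final isZ₁ n a (λ s → eval g (st s (m ∷ b)))
  Eᵇ = final isZ₁ m b (λ s → eval g (st (n ∷ a) s))

  first-n : Leibniz gₙ a (m ∷ b) → eval (λ t → ρᶻ g (n ∷ t)) (st a (m ∷ b)) ≡ (A₁ + (B₁ + Eᵇ)) + 0ℚ
  first-n IH = begin
    eval (λ t → ρᶻ g (n ∷ t)) (st a (m ∷ b))
      ≡⟨ eval-ρ-∷ isZ₁ g n (st a (m ∷ b)) ⟩
    eval (ρᶻ gₙ) (st a (m ∷ b)) + eval (λ t → final isZ₁ n t g) (st a (m ∷ b))
      ≡⟨ cong₂ _+_ IH (eval-st-nonemptyʳ (λ _ _ → refl) a m b) ⟩
    (A₁ + ρᶻ (λ s → eval gₙ (st a s)) (m ∷ b)) + 0ℚ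
      ≡⟨ cong (λ r → (A₁ + r) + 0ℚ) (ρ-∷ isZ₁ (λ s → eval gₙ (st a s)) m b) ⟩
    (A₁ + (B₁ + final isZ₁ m b (λ s → eval gₙ (st a s)))) + 0ℚ
      ≡⟨ cong (λ r → (A₁ + (B₁ + r)) + 0ℚ)
           (final-cong isZ₁ (trans (cong (eval gₙ) (st-[]ʳ a)) (cong (eval g) (sym (st-[]ʳ (n ∷ a))))) m b) ⟩
    (A₁ + (B₁ + Eᵇ)) + 0ℚ ∎

  first-m : Leibniz gₘ (n ∷ a) b → eval (λ t → ρᶻ g (m ∷ t)) (st (n ∷ a) b) ≡ ((A₂ + Eᵃ) + B₂) + 0ℚ
  first-m IH = begin
    eval (λ t → ρᶻ g (m ∷ t)) (st (n ∷ a) b)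
      ≡⟨ eval-ρ-∷ isZ₁ g m (st (n ∷ a) b) ⟩
    eval (ρᶻ gₘ) (st (n ∷ a) b) + eval (λ t → final isZ₁ m t g) (st (n ∷ a) b)
      ≡⟨ cong₂ _+_ IH (eval-st-nonemptyˡ (λ _ _ → refl) n a b) ⟩
    (ρᶻ (λ s → eval gₘ (st s b)) (n ∷ a) + B₂) + 0ℚ
      ≡⟨ cong (λ r → (r + B₂) + 0ℚ) (ρ-∷ isZ₁ (λ s → eval gₘ (st s b)) n a) ⟩
    ((A₂ + final isZ₁ n a (λ s → eval gₘ (st s b))) + B₂) + 0ℚ
      ≡⟨ cong (λ r → ((A₂ + r) + B₂) + 0ℚ) (final-cong isZ₁ refl n a) ⟩
    ((A₂ + Eᵃ) + B₂) + 0ℚ ∎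

  first-k : Leibniz gₖ a b → eval (λ t → ρᶻ g (k ∷ t)) (st a b) ≡ (A₃ + B₃) + 0ℚ
  first-k IH = begin
    eval (λ t → ρᶻ g (k ∷ t)) (st a b)
      ≡⟨ eval-ρ-∷ isZ₁ g k (st a b) ⟩
    eval (ρᶻ gₖ) (st a b) + eval (λ t → final isZ₁ k t g) (st a b)
      ≡⟨ cong₂ _+_ IH
           (trans (eval-cong (st a b) (λ t → final-unselected isZ₁ k refl t g)) (eval-zero (st a b))) ⟩
    (A₃ + B₃) + 0ℚ ∎

  left : ρᶻ (λ s → eval g (st s (m ∷ b))) (n ∷ a) ≡ (A₁ + (A₂ + A₃)) + Eᵃ
  left = begin
    ρᶻ (λ s → eval g (st s (m ∷ b))) (n ∷ a)
      ≡⟨ ρ-∷ isZ₁ _ n a ⟩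
    ρᶻ (λ s → eval g (st (n ∷ s) (m ∷ b))) a + Eᵃ
      ≡⟨ cong (_+ Eᵃ) (ρ-cong isZ₁ (λ s → eval-st-∷ g n s m b) a) ⟩
    ρᶻ (λ s → eval gₙ (st s (m ∷ b)) + (eval gₘ (st (n ∷ s) b) + eval gₖ (st s b))) a + Eᵃ
      ≡⟨ cong (_+ Eᵃ) (trans (ρ-+ isZ₁ _ _ a) (cong (A₁ +_) (ρ-+ isZ₁ _ _ a))) ⟩
    (A₁ + (A₂ + A₃)) + Eᵃ ∎

  right : ρᶻ (λ s → eval g (st (n ∷ a) s)) (m ∷ b) ≡ (B₁ + (B₂ + B₃)) + Eᵇ
  right = begin
    ρᶻ (λ s → eval g (st (n ∷ a) s)) (m ∷ b)
      ≡⟨ ρ-∷ isZ₁ _ m b ⟩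
    ρᶻ (λ s → eval g (st (n ∷ a) (m ∷ s))) b + Eᵇ
      ≡⟨ cong (_+ Eᵇ) (ρ-cong isZ₁ (λ s → eval-st-∷ g n a m s) b) ⟩
    ρᶻ (λ s → eval gₙ (st a (m ∷ s)) + (eval gₘ (st (n ∷ a) s) + eval gₖ (st a s))) b + Eᵇ
      ≡⟨ cong (_+ Eᵇ) (trans (ρ-+ isZ₁ _ _ b) (cong (B₁ +_) (ρ-+ isZ₁ _ _ b))) ⟩
    (B₁ + (B₂ + B₃)) + Eᵇ ∎

eval-stP : (h : ZWord → ℚ) (a : ZWord) (T : PolyZ) → eval h (stP a T) ≡ eval (λ t → eval h (st a t)) T
eval-stP h a = eval-concatMap h (st a) _ (λ _ _ → refl)

ρᶻ-derivation-stP : ∀ g a T → eval (ρᶻ g) (stP a T) ≡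
                    ρᶻ (λ a′ → eval g (stP a′ T)) a + eval (ρᶻ (λ t′ → eval g (st a t′))) T
ρᶻ-derivation-stP g a T = begin
  eval (ρᶻ g) (stP a T)
    ≡⟨ eval-stP (ρᶻ g) a T ⟩
  eval (λ t → eval (ρᶻ g) (st a t)) T
    ≡⟨ eval-cong T (ρᶻ-derivation g a) ⟩
  eval (λ t → ρᶻ (λ a′ → eval g (st a′ t)) a + ρᶻ (λ t′ → eval g (st a t′)) t) T
    ≡⟨ eval-+ _ _ T ⟩
  eval (λ t → ρᶻ (λ a′ → eval g (st a′ t)) a) T + R
    ≡⟨ cong (_+ R) (ρ-eval isZ₁ (λ a′ t → eval g (st a′ t)) T a) ⟨
  ρᶻ (λ a′ → eval (λ t → eval g (st a′ t)) T) a + R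
    ≡⟨ cong (_+ R) (ρ-cong isZ₁ (λ a′ → eval-stP g a′ T) a) ⟨
  ρᶻ (λ a′ → eval g (stP a′ T)) a + R ∎
  where R = eval (ρᶻ (λ t′ → eval g (st a t′))) T

isY : Letter → Bool
isY x = false
isY y = true

ρʸ : (Word → ℚ) → Word → ℚ
ρʸ = ρ isY

eval-S₁-nilSupported : {h : Word → ℚ} → NilSupported h → ∀ w → eval h (S₁ w) ≡ h w
eval-S₁-nilSupported {h} h₀ [] = eval-1 h []
eval-S₁-nilSupported {h} h₀ (x ∷ w) = begin
  eval h (lmul x (S₁ w))           ≡⟨ eval-lmul h x (S₁ w) ⟩
  eval (λ t → h (x ∷ t)) (S₁ w)    ≡⟨ eval-nilSupported-∷ {h = h} h₀ x (S₁ w) ⟩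
  0ℚ                               ≡⟨ h₀ x w ⟨
  h (x ∷ w)                        ∎
eval-S₁-nilSupported {h} h₀ (y ∷ w) = begin
  eval h (lmul x (S₁ w) ++ lmul y (S₁ w))
    ≡⟨ eval-++ h (lmul x (S₁ w)) (lmul y (S₁ w)) ⟩
  eval h (lmul x (S₁ w)) + eval h (lmul y (S₁ w))
    ≡⟨ cong₂ _+_ (trans (eval-lmul h x (S₁ w)) (eval-nilSupported-∷ {h = h} h₀ x (S₁ w)))
                 (trans (eval-lmul h y (S₁ w)) (eval-nilSupported-∷ {h = h} h₀ y (S₁ w))) ⟩
  0ℚ + 0ℚ
    ≡⟨ h₀ y w ⟨
  h (y ∷ w) ∎

-- S₁ (u y) = S₁ u (x + y) and S₁ (u x) = S₁ u x.
mutual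
  ρʸ-S₁ : ∀ F w → eval (ρʸ F) (S₁ w) ≡ ρʸ (λ w′ → eval F (S₁ w′)) w
  ρʸ-S₁ F []      = refl
  ρʸ-S₁ F (x ∷ w) = begin
    eval (ρʸ F) (lmul x (S₁ w))
      ≡⟨ ρʸ-lmul-S₁ F x w ⟩
    ρʸ (λ s → eval F (S₁ (x ∷ s))) w + final isY x w F
      ≡⟨ cong (ρʸ (λ s → eval F (S₁ (x ∷ s))) w +_) (final-cong isY (eval-1 F []) x w) ⟨
    ρʸ (λ s → eval F (S₁ (x ∷ s))) w + final isY x w (λ s → eval F (S₁ s))
      ≡⟨ ρ-∷ isY _ x w ⟨
    ρʸ (λ s → eval F (S₁ s)) (x ∷ w) ∎
  ρʸ-S₁ F (y ∷ w) = begin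
    eval (ρʸ F) (lmul x (S₁ w) ++ lmul y (S₁ w))
      ≡⟨ eval-++ (ρʸ F) (lmul x (S₁ w)) (lmul y (S₁ w)) ⟩
    eval (ρʸ F) (lmul x (S₁ w)) + eval (ρʸ F) (lmul y (S₁ w))
      ≡⟨ cong₂ _+_ (ρʸ-lmul-S₁ F x w) (ρʸ-lmul-S₁ F y w) ⟩
    (A + final isY x w F) + (B + final isY y w F)
      ≡⟨ cong (λ r → (A + r) + (B + final isY y w F)) (final-unselected isY x refl w F) ⟩
    (A + 0ℚ) + (B + final isY y w F)
      ≡⟨ solve 3 (λ a b e → (a :+ con 0ℚ) :+ (b :+ e) := (a :+ b) :+ e) refl A B (final isY y w F) ⟩
    (A + B) + final isY y w F
      ≡⟨ cong₂ _+_ (ρ-+ isY _ _ w) (final-cong isY (eval-1 F []) y w) ⟨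
    ρʸ (λ s → eval F (lmul x (S₁ s)) + eval F (lmul y (S₁ s))) w + final isY y w (λ s → eval F (S₁ s))
      ≡⟨ cong (_+ final isY y w (λ s → eval F (S₁ s))) (ρ-cong isY (λ s → eval-++ F (lmul x (S₁ s)) (lmul y (S₁ s))) w) ⟨
    ρʸ (λ s → eval F (S₁ (y ∷ s))) w + final isY y w (λ s → eval F (S₁ s))
      ≡⟨ ρ-∷ isY _ y w ⟨
    ρʸ (λ s → eval F (S₁ s)) (y ∷ w) ∎
    where
    A = ρʸ (λ s → eval F (lmul x (S₁ s))) w
    B = ρʸ (λ s → eval F (lmul y (S₁ s))) w

  ρʸ-lmul-S₁ : ∀ F a w → eval (ρʸ F) (lmul a (S₁ w)) ≡ ρʸ (λ s → eval F (lmul a (S₁ s))) w + final isY a w F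
  ρʸ-lmul-S₁ F a w = begin
    eval (ρʸ F) (lmul a (S₁ w))                   ≡⟨ eval-lmul (ρʸ F) a (S₁ w) ⟩
    eval (λ t → ρʸ F (a ∷ t)) (S₁ w)              ≡⟨ eval-ρ-∷ isY F a (S₁ w) ⟩
    eval (ρʸ (λ t → F (a ∷ t))) (S₁ w) + eval (λ t → final isY a t F) (S₁ w)
      ≡⟨ cong₂ _+_ (ρʸ-S₁ (λ t → F (a ∷ t)) w)
                   (eval-S₁-nilSupported {h = λ t → final isY a t F} (λ _ _ → refl) w) ⟩
    ρʸ (λ s → eval (λ t → F (a ∷ t)) (S₁ s)) w + final isY a w F
      ≡⟨ cong (_+ final isY a w F) (ρ-cong isY (λ s → eval-lmul F a (S₁ s)) w) ⟨
    ρʸ (λ s → eval F (lmul a (S₁ s))) w + final isY a w F ∎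

eval-sh-nilSupported : {h : Word → ℚ} → NilSupported h → ∀ u b v → eval h (sh u (b ∷ v)) ≡ 0ℚ
eval-sh-nilSupported {h} h₀ []      b v rewrite h₀ b v = refl
eval-sh-nilSupported {h} h₀ (a ∷ u) b v = begin
  eval h (lmul a (sh u (b ∷ v)) ++ lmul b (sh (a ∷ u) v))
    ≡⟨ eval-++ h (lmul a (sh u (b ∷ v))) (lmul b (sh (a ∷ u) v)) ⟩
  eval h (lmul a (sh u (b ∷ v))) + eval h (lmul b (sh (a ∷ u) v))
    ≡⟨ cong₂ _+_ (trans (eval-lmul h a (sh u (b ∷ v))) (eval-nilSupported-∷ {h = h} h₀ a (sh u (b ∷ v))))
                 (trans (eval-lmul h b (sh (a ∷ u) v)) (eval-nilSupported-∷ {h = h} h₀ b (sh (a ∷ u) v))) ⟩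
  0ℚ + 0ℚ ≡⟨⟩
  0ℚ ∎

-- The final y of a word in u ш x is the final y of u.
ρʸ-sh-x : ∀ F u → eval (ρʸ F) (sh u (x ∷ [])) ≡ ρʸ (λ u′ → eval F (sh u′ (x ∷ []))) u
ρʸ-sh-x F []      = refl
ρʸ-sh-x F (a ∷ u) = begin
  eval (ρʸ F) (lmul a (sh u (x ∷ [])) ++ lmul x ((1ℚ , a ∷ u) ∷ []))
    ≡⟨ eval-++ (ρʸ F) (lmul a (sh u (x ∷ []))) (lmul x ((1ℚ , a ∷ u) ∷ [])) ⟩
  eval (ρʸ F) (lmul a (sh u (x ∷ []))) + eval (ρʸ F) (lmul x ((1ℚ , a ∷ u) ∷ []))
    ≡⟨ cong₂ _+_ a-first (eval-1 (ρʸ F) (x ∷ a ∷ u)) ⟩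
  (P + 0ℚ) + ρʸ (λ s → F (x ∷ s)) (a ∷ u)
    ≡⟨ cong ((P + 0ℚ) +_) (ρ-∷ isY (λ s → F (x ∷ s)) a u) ⟩
  (P + 0ℚ) + (Q + final isY a u (λ s → F (x ∷ s)))
    ≡⟨ cong (λ r → (P + 0ℚ) + (Q + r)) (final-cong isY (eval-1 F (x ∷ [])) a u) ⟨
  (P + 0ℚ) + (Q + E)
    ≡⟨ solve 3 (λ p q e → (p :+ con 0ℚ) :+ (q :+ e) := (p :+ q) :+ e) refl P Q E ⟩
  (P + Q) + E
    ≡⟨ cong (_+ E) (ρ-+ isY _ _ u) ⟨
  ρʸ (λ s → eval (λ t → F (a ∷ t)) (sh s (x ∷ [])) + F (x ∷ a ∷ s)) u + E
    ≡⟨ cong (_+ E) (ρ-cong isY a-or-x u) ⟨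
  ρʸ (λ s → eval F (sh (a ∷ s) (x ∷ []))) u + E
    ≡⟨ ρ-∷ isY _ a u ⟨
  ρʸ (λ u′ → eval F (sh u′ (x ∷ []))) (a ∷ u) ∎
  where
  P = ρʸ (λ s → eval (λ t → F (a ∷ t)) (sh s (x ∷ []))) u
  Q = ρʸ (λ s → F (x ∷ a ∷ s)) u
  E = final isY a u (λ s → eval F (sh s (x ∷ [])))

  a-first : eval (ρʸ F) (lmul a (sh u (x ∷ []))) ≡ P + 0ℚ
  a-first = begin
    eval (ρʸ F) (lmul a (sh u (x ∷ [])))      ≡⟨ eval-lmul (ρʸ F) a (sh u (x ∷ [])) ⟩
    eval (λ t → ρʸ F (a ∷ t)) (sh u (x ∷ [])) ≡⟨ eval-ρ-∷ isY F a (sh u (x ∷ [])) ⟩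
    eval (ρʸ (λ t → F (a ∷ t))) (sh u (x ∷ [])) + eval (λ t → final isY a t F) (sh u (x ∷ []))
      ≡⟨ cong₂ _+_ (ρʸ-sh-x (λ t → F (a ∷ t)) u)
                   (eval-sh-nilSupported {h = λ t → final isY a t F} (λ _ _ → refl) u x []) ⟩
    P + 0ℚ ∎

  a-or-x : ∀ s → eval F (sh (a ∷ s) (x ∷ [])) ≡ eval (λ t → F (a ∷ t)) (sh s (x ∷ [])) + F (x ∷ a ∷ s)
  a-or-x s = begin
    eval F (lmul a (sh s (x ∷ [])) ++ lmul x ((1ℚ , a ∷ s) ∷ []))
      ≡⟨ eval-++ F (lmul a (sh s (x ∷ []))) (lmul x ((1ℚ , a ∷ s) ∷ [])) ⟩
    eval F (lmul a (sh s (x ∷ []))) + eval F (lmul x ((1ℚ , a ∷ s) ∷ []))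
      ≡⟨ cong₂ _+_ (eval-lmul F a (sh s (x ∷ []))) (eval-1 F (x ∷ a ∷ s)) ⟩
    eval (λ t → F (a ∷ t)) (sh s (x ∷ [])) + F (x ∷ a ∷ s) ∎

-- The contribution to ρᶻ G (parseY n w) of the letter z_(n+1) being parsed,
-- which is final iff w = [].
parse-final : ℕ → Word → (ZWord → ℚ) → ℚ
parse-final n []      G = if isZ₁ n then G [] else 0ℚ
parse-final n (_ ∷ _) G = 0ℚ

final-parseY : ∀ a k w (G : ZWord → ℚ) → final isZ₁ a (parseY k w) G ≡ 0ℚ
final-parseY a k []      G = refl
final-parseY a k (x ∷ w) G = final-parseY a (suc k) w G
final-parseY a k (y ∷ w) G = refl

ρᶻ-parseY : ∀ G n w → ρᶻ G (parseY n w) ≡ ρʸ (λ s → G (parseY n s)) w + parse-final n w G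
ρᶻ-parseY G n []      = sym (ℚ.+-identityˡ _)
ρᶻ-parseY G n (x ∷ w) = begin
  ρᶻ G (parseY (suc n) w)                           ≡⟨ ρᶻ-parseY G (suc n) w ⟩
  A + parse-final (suc n) w G                       ≡⟨ cong (A +_) (no-final w) ⟩
  A + 0ℚ                                            ≡⟨ ℚ.+-identityʳ (A + 0ℚ) ⟨
  (A + 0ℚ) + 0ℚ                                     ≡⟨ cong (λ r → (A + r) + 0ℚ) (final-unselected isY x refl w _) ⟨
  (A + final isY x w (λ s → G (parseY n s))) + 0ℚ   ≡⟨ cong (_+ 0ℚ) (ρ-∷ isY _ x w) ⟨
  ρʸ (λ s → G (parseY n s)) (x ∷ w) + 0ℚ           ∎
  where
  A = ρʸ (λ s → G (parseY (suc n) s)) w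
  no-final : ∀ w → parse-final (suc n) w G ≡ 0ℚ
  no-final []      = refl
  no-final (_ ∷ _) = refl
ρᶻ-parseY G n (y ∷ w) = begin
  ρᶻ G (n ∷ parseY 0 w)
    ≡⟨ ρ-∷ isZ₁ G n (parseY 0 w) ⟩
  ρᶻ (λ s → G (n ∷ s)) (parseY 0 w) + final isZ₁ n (parseY 0 w) G
    ≡⟨ cong₂ _+_ (ρᶻ-parseY (λ s → G (n ∷ s)) 0 w) (final-parseY n 0 w G) ⟩
  (B + parse-final 0 w (λ s → G (n ∷ s))) + 0ℚ
    ≡⟨ cong (λ r → (B + r) + 0ℚ) (y-final w) ⟨
  (B + final isY y w (λ s → G (parseY n s))) + 0ℚ
    ≡⟨ cong (_+ 0ℚ) (ρ-∷ isY _ y w) ⟨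
  ρʸ (λ s → G (parseY n s)) (y ∷ w) + 0ℚ ∎
  where
  B = ρʸ (λ s → G (n ∷ parseY 0 s)) w
  y-final : ∀ w → final isY y w (λ s → G (parseY n s)) ≡ parse-final 0 w (λ s → G (n ∷ s))
  y-final []      = refl
  y-final (_ ∷ _) = refl

mutual
  parseY-fromZ : ∀ k ns → parseY k (fromZ ns) ≡ k ∷ ns
  parseY-fromZ k []       = refl
  parseY-fromZ k (m ∷ ms) = cong (k ∷_) (parseY-xⁿ-fromZ 0 m ms)

  parseY-xⁿ-fromZ : ∀ k n ns → parseY k (replicate n x ++ fromZ ns) ≡ (k +ℕ n) ∷ ns
  parseY-xⁿ-fromZ k zero    ns rewrite ℕ.+-identityʳ k = parseY-fromZ k ns
  parseY-xⁿ-fromZ k (suc n) ns rewrite ℕ.+-suc k n    = parseY-xⁿ-fromZ (suc k) n ns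

xⁿ-++-x∷ : ∀ n w → replicate n x ++ x ∷ w ≡ x ∷ (replicate n x ++ w)
xⁿ-++-x∷ zero    w = refl
xⁿ-++-x∷ (suc n) w = cong (x ∷_) (xⁿ-++-x∷ n w)

fromZ-parseY : ∀ k w → fromZ (parseY k w) ≡ y ∷ (replicate k x ++ w)
fromZ-parseY k []      = refl
fromZ-parseY k (x ∷ w) = trans (fromZ-parseY (suc k) w) (cong (y ∷_) (sym (xⁿ-++-x∷ k w)))
fromZ-parseY k (y ∷ w) = cong (λ r → y ∷ (replicate k x ++ r)) (fromZ-parseY 0 w)

eval-S̃-fromZ : ∀ G t w → fromZ t ≡ y ∷ w → eval G (S̃ t) ≡ - sign w * eval (λ s → G (parseY 0 s)) (S₁ w)
eval-S̃-fromZ G (n ∷ ns) _ refl = begin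
  eval G (scaleZ (sign (fromZ (n ∷ ns))) (S (n ∷ ns)))
    ≡⟨ eval-scaleZ G (sign (fromZ (n ∷ ns))) (S (n ∷ ns)) ⟩
  sign (fromZ (n ∷ ns)) * eval G (S (n ∷ ns))
    ≡⟨ cong (sign (fromZ (n ∷ ns)) *_) (eval-map G (parseY 0) _ (λ _ _ → refl) (S₁ (replicate n x ++ fromZ ns))) ⟩
  sign (fromZ (n ∷ ns)) * eval (λ s → G (parseY 0 s)) (S₁ (replicate n x ++ fromZ ns)) ∎

eval-σ₁-fromZ : ∀ H t w → fromZ t ≡ y ∷ w → eval H (σ 1 t) ≡ eval (λ s → H (parseY 0 s)) (sh w (x ∷ []))
eval-σ₁-fromZ H (n ∷ ns) _ refl = eval-map H (parseY 0) _ (λ _ _ → refl) (sh (replicate n x ++ fromZ ns) (x ∷ []))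

ρʸ-sign : ∀ K w → ρʸ (λ s → - sign s * K s) w ≡ sign w * ρʸ K w
ρʸ-sign K []          = refl
ρʸ-sign K (x ∷ [])    = refl
ρʸ-sign K (y ∷ [])    = refl
ρʸ-sign K (x ∷ b ∷ t) = ρʸ-sign (λ s → K (x ∷ s)) (b ∷ t)
ρʸ-sign K (y ∷ b ∷ t) = begin
  ρʸ (λ s → - - sign s * K (y ∷ s)) (b ∷ t)  ≡⟨ ρ-cong isY (λ s → neg-swap (sign s) (K (y ∷ s))) (b ∷ t) ⟩
  ρʸ (λ s → - sign s * - K (y ∷ s)) (b ∷ t)  ≡⟨ ρʸ-sign (λ s → - K (y ∷ s)) (b ∷ t) ⟩
  sign (b ∷ t) * ρʸ (λ s → - K (y ∷ s)) (b ∷ t) ≡⟨ cong (sign (b ∷ t) *_) (ρ-neg isY (λ s → K (y ∷ s)) (b ∷ t)) ⟩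
  sign (b ∷ t) * - ρʸ (λ s → K (y ∷ s)) (b ∷ t)
    ≡⟨ solve 2 (λ a r → a :* (:- r) := (:- a) :* r) refl (sign (b ∷ t)) (ρʸ (λ s → K (y ∷ s)) (b ∷ t)) ⟩
  - sign (b ∷ t) * ρʸ (λ s → K (y ∷ s)) (b ∷ t) ∎
  where
  neg-swap : ∀ a k → - - a * k ≡ - a * - k
  neg-swap = solve 2 (λ a k → :- (:- a) :* k := :- a :* (:- k)) refl

-- d contributes the sign of the removed y, hence ρᶻ anticommutes with S̃ = S ∘ d.
ρᶻ-S̃ : ∀ G t → eval (ρᶻ G) (S̃ t) ≡ - ρᶻ (λ t′ → eval G (S̃ t′)) t
ρᶻ-S̃ G []       = refl
ρᶻ-S̃ G (n ∷ ns) = begin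
  eval (ρᶻ G) (S̃ (n ∷ ns))
    ≡⟨ eval-S̃-fromZ (ρᶻ G) (n ∷ ns) w refl ⟩
  - sign w * eval (λ s → ρᶻ G (parseY 0 s)) (S₁ w)
    ≡⟨ cong (- sign w *_) (eval-cong (S₁ w) (ρᶻ-parseY G 0)) ⟩
  - sign w * eval (λ s → ρʸ G′ s + parse-final 0 s G) (S₁ w)
    ≡⟨ cong (- sign w *_) (eval-+ (ρʸ G′) _ (S₁ w)) ⟩
  - sign w * (eval (ρʸ G′) (S₁ w) + eval (λ s → parse-final 0 s G) (S₁ w))
    ≡⟨ cong (- sign w *_) (cong₂ _+_ (ρʸ-S₁ G′ w)
                             (eval-S₁-nilSupported {h = λ s → parse-final 0 s G} (λ _ _ → refl) w)) ⟩
  - sign w * (ρʸ K w + parse-final 0 w G)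
    ≡⟨ solve 3 (λ s a b → :- s :* (a :+ b) := :- (s :* a :+ s :* b)) refl (sign w) (ρʸ K w) (parse-final 0 w G) ⟩
  - (sign w * ρʸ K w + sign w * parse-final 0 w G)
    ≡⟨ cong -_ (cong₂ _+_ (ρʸ-sign K w) (parse-final-S̃ w)) ⟨
  - (ρʸ (λ s → - sign s * K s) w + parse-final 0 w H)
    ≡⟨ cong (λ r → - (r + parse-final 0 w H)) (ρ-cong isY (λ s → eval-S̃-fromZ G (parseY 0 s) s (fromZ-parseY 0 s)) w) ⟨
  - (ρʸ (λ s → H (parseY 0 s)) w + parse-final 0 w H)
    ≡⟨ cong -_ (ρᶻ-parseY H 0 w) ⟨
  - ρᶻ H (parseY 0 w)
    ≡⟨ cong (λ t → - ρᶻ H t) (parseY-xⁿ-fromZ 0 n ns) ⟩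
  - ρᶻ H (n ∷ ns) ∎
  where
  w  = replicate n x ++ fromZ ns
  G′ = λ s → G (parseY 0 s)
  K  = λ w′ → eval G′ (S₁ w′)
  H  = λ t′ → eval G (S̃ t′)
  parse-final-S̃ : ∀ w → parse-final 0 w H ≡ sign w * parse-final 0 w G
  parse-final-S̃ []      = solve 1 (λ g → con 1ℚ :* con 1ℚ :* g :+ con 0ℚ := con 1ℚ :* g) refl (G [])
  parse-final-S̃ (a ∷ w) = sym (ℚ.*-zeroʳ (sign (a ∷ w)))

ρᶻ-σ₁ : ∀ H W → eval (ρᶻ H) (σ 1 W) ≡ ρᶻ (λ W′ → eval H (σ 1 W′)) W
ρᶻ-σ₁ H []       = refl
ρᶻ-σ₁ H (n ∷ ns) = begin
  eval (ρᶻ H) (σ 1 (n ∷ ns))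
    ≡⟨ eval-σ₁-fromZ (ρᶻ H) (n ∷ ns) w refl ⟩
  eval (λ s → ρᶻ H (parseY 0 s)) (sh w (x ∷ []))
    ≡⟨ eval-cong (sh w (x ∷ [])) (ρᶻ-parseY H 0) ⟩
  eval (λ s → ρʸ H′ s + parse-final 0 s H) (sh w (x ∷ []))
    ≡⟨ eval-+ (ρʸ H′) _ (sh w (x ∷ [])) ⟩
  eval (ρʸ H′) (sh w (x ∷ [])) + eval (λ s → parse-final 0 s H) (sh w (x ∷ []))
    ≡⟨ cong₂ _+_ (ρʸ-sh-x H′ w) (eval-sh-nilSupported {h = λ s → parse-final 0 s H} (λ _ _ → refl) w x []) ⟩
  ρʸ (λ u → eval H′ (sh u (x ∷ []))) w + 0ℚ
    ≡⟨ cong₂ _+_ (ρ-cong isY (λ s → eval-σ₁-fromZ H (parseY 0 s) s (fromZ-parseY 0 s)) w) (no-final w) ⟨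
  ρʸ (λ s → H″ (parseY 0 s)) w + parse-final 0 w H″
    ≡⟨ ρᶻ-parseY H″ 0 w ⟨
  ρᶻ H″ (parseY 0 w)
    ≡⟨ cong (ρᶻ H″) (parseY-xⁿ-fromZ 0 n ns) ⟩
  ρᶻ H″ (n ∷ ns) ∎
  where
  w  = replicate n x ++ fromZ ns
  H′ = λ s → H (parseY 0 s)
  H″ = λ W′ → eval H (σ 1 W′)
  no-final : ∀ w → parse-final 0 w H″ ≡ 0ℚ
  no-final []      = refl
  no-final (_ ∷ _) = refl

eval-S̃P : (h : ZWord → ℚ) (P : PolyZ) → eval h (S̃P P) ≡ eval (λ t → eval h (S̃ t)) P
eval-S̃P h = eval-concatMap h S̃ _ (λ _ _ → refl)

ρᶻ-S̃σ₁ : ∀ G W → eval (ρᶻ G) (S̃P (σ 1 W)) ≡ - ρᶻ (λ W′ → eval G (S̃P (σ 1 W′))) W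
ρᶻ-S̃σ₁ G W = begin
  eval (ρᶻ G) (S̃P (σ 1 W))                         ≡⟨ eval-S̃P (ρᶻ G) (σ 1 W) ⟩
  eval (λ t → eval (ρᶻ G) (S̃ t)) (σ 1 W)           ≡⟨ eval-cong (σ 1 W) (ρᶻ-S̃ G) ⟩
  eval (λ t → - ρᶻ (λ t′ → eval G (S̃ t′)) t) (σ 1 W) ≡⟨ eval-neg _ (σ 1 W) ⟩
  - eval (ρᶻ (λ t′ → eval G (S̃ t′))) (σ 1 W)       ≡⟨ cong -_ (ρᶻ-σ₁ (λ t′ → eval G (S̃ t′)) W) ⟩
  - ρᶻ (λ W′ → eval (λ t′ → eval G (S̃ t′)) (σ 1 W′)) W ≡⟨ cong -_ (ρ-cong isZ₁ (λ W′ → eval-S̃P G (σ 1 W′)) W) ⟨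
  - ρᶻ (λ W′ → eval G (S̃P (σ 1 W′))) W             ∎

-- Telescoping

S̃σ₁-suffix : ZWord → ℕ → PolyZ
S̃σ₁-suffix w i = S̃P (σ 1 (reverse (drop i w)))

telescope-term : (ZWord → ℚ) → ZWord → ℕ → ℚ
telescope-term g w i = ρᶻ (λ a → eval g (stP a (S̃σ₁-suffix w i))) (take i w)

take-drop-step : ∀ i (w : ZWord) → suc i ≤ length w →
                 Σ[ k ∈ ℕ ] (drop i w ≡ k ∷ drop (suc i) w) × (take (suc i) w ≡ take i w ∷ʳ k)
take-drop-step zero    (k ∷ w) _       = k , refl , refl
take-drop-step (suc i) (a ∷ w) (s≤s i<) with take-drop-step i w i<
... | k , drop≡ , take≡ = k , drop≡ , cong (a ∷_) take≡

ρᶻ-ψ-sum : ∀ g w i → i ≤ length w → eval (ρᶻ g) (ψ-sum w i) ≡ - telescope-term g w i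
ρᶻ-ψ-sum g w zero    _  = refl
ρᶻ-ψ-sum g w (suc i) i< with take-drop-step i w i<
... | k , drop≡ , take≡ = begin
  eval (ρᶻ g) (ψ-sum w i ++ stP (take i w) (S̃σ₁-suffix w i))
    ≡⟨ eval-++ (ρᶻ g) (ψ-sum w i) (stP (take i w) (S̃σ₁-suffix w i)) ⟩
  eval (ρᶻ g) (ψ-sum w i) + eval (ρᶻ g) (stP (take i w) (S̃σ₁-suffix w i))
    ≡⟨ cong₂ _+_ (ρᶻ-ψ-sum g w i (ℕ.<⇒≤ i<)) (ρᶻ-derivation-stP g (take i w) (S̃σ₁-suffix w i)) ⟩
  - C + (C + eval (ρᶻ Gᵢ) (S̃σ₁-suffix w i))
    ≡⟨ cong (λ r → - C + (C + r)) next-term ⟩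
  - C + (C + - X)
    ≡⟨ solve 2 (λ c q → :- c :+ (c :+ :- q) := :- q) refl C X ⟩
  - X
    ≡⟨ cong -_ next-term′ ⟨
  - telescope-term g w (suc i) ∎
  where
  C  = telescope-term g w i
  Gᵢ = λ t → eval g (st (take i w) t)
  X  = if isZ₁ k then eval g (stP (take i w) (S̃σ₁-suffix w (suc i))) else 0ℚ

  next-term : eval (ρᶻ Gᵢ) (S̃σ₁-suffix w i) ≡ - X
  next-term = begin
    eval (ρᶻ Gᵢ) (S̃σ₁-suffix w i)
      ≡⟨ ρᶻ-S̃σ₁ Gᵢ (reverse (drop i w)) ⟩
    - ρᶻ (λ W → eval Gᵢ (S̃P (σ 1 W))) (reverse (drop i w))
      ≡⟨ cong (λ W → - ρᶻ (λ W → eval Gᵢ (S̃P (σ 1 W))) W)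
              (trans (cong reverse drop≡) (List.unfold-reverse k (drop (suc i) w))) ⟩
    - ρᶻ (λ W → eval Gᵢ (S̃P (σ 1 W))) (reverse (drop (suc i) w) ∷ʳ k)
      ≡⟨ cong -_ (ρ-∷ʳ isZ₁ _ (reverse (drop (suc i) w)) k) ⟩
    - (if isZ₁ k then eval Gᵢ (S̃σ₁-suffix w (suc i)) else 0ℚ)
      ≡⟨ cong (λ r → - (if isZ₁ k then r else 0ℚ)) (eval-stP g (take i w) (S̃σ₁-suffix w (suc i))) ⟨
    - X ∎

  next-term′ : telescope-term g w (suc i) ≡ X
  next-term′ = begin
    ρᶻ (λ a → eval g (stP a (S̃σ₁-suffix w (suc i)))) (take (suc i) w)
      ≡⟨ cong (ρᶻ (λ a → eval g (stP a (S̃σ₁-suffix w (suc i))))) take≡ ⟩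
    ρᶻ (λ a → eval g (stP a (S̃σ₁-suffix w (suc i)))) (take i w ∷ʳ k)
      ≡⟨ ρ-∷ʳ isZ₁ _ (take i w) k ⟩
    X ∎

ρᶻ-ψ : ∀ g w → eval (ρᶻ g) (ψ w) ≡ 0ℚ
ρᶻ-ψ g w = begin
  eval (ρᶻ g) (ψ w)                   ≡⟨ ρᶻ-ψ-sum g w (length w) ℕ.≤-refl ⟩
  - telescope-term g w (length w)     ≡⟨ cong (λ d → - ρᶻ (λ a → eval g (stP a (S̃P (σ 1 (reverse d))))) (take (length w) w))
                                            (List.drop-all (length w) w ℕ.≤-refl) ⟩
  - ρᶻ (λ _ → 0ℚ) (take (length w) w) ≡⟨ cong -_ (ρ-zero isZ₁ (take (length w) w)) ⟩
  0ℚ                                  ∎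

-- The constant term

nilSupported-parseY : {φ : ZWord → ℚ} → NilSupported φ → ∀ k w → φ (parseY k w) ≡ 0ℚ
nilSupported-parseY {φ} φ₀ k []      = φ₀ k []
nilSupported-parseY {φ} φ₀ k (x ∷ w) = nilSupported-parseY {φ} φ₀ (suc k) w
nilSupported-parseY {φ} φ₀ k (y ∷ w) = φ₀ k (parseY 0 w)

nilSupported-S̃ : {φ : ZWord → ℚ} → NilSupported φ → NilSupported (λ t → eval φ (S̃ t))
nilSupported-S̃ {φ} φ₀ n ns = begin
  eval φ (S̃ (n ∷ ns))
    ≡⟨ eval-S̃-fromZ φ (n ∷ ns) w refl ⟩
  - sign w * eval (λ s → φ (parseY 0 s)) (S₁ w)
    ≡⟨ cong (- sign w *_) (trans (eval-cong (S₁ w) (nilSupported-parseY {φ} φ₀ 0)) (eval-zero (S₁ w))) ⟩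
  - sign w * 0ℚ
    ≡⟨ ℚ.*-zeroʳ (- sign w) ⟩
  0ℚ ∎
  where w = replicate n x ++ fromZ ns

eval-S̃σ₁-nilSupported : {φ : ZWord → ℚ} → NilSupported φ → ∀ W → eval φ (S̃P (σ 1 W)) ≡ 0ℚ
eval-S̃σ₁-nilSupported {φ} φ₀ []       = refl
eval-S̃σ₁-nilSupported {φ} φ₀ (n ∷ ns) = begin
  eval φ (S̃P (σ 1 (n ∷ ns)))
    ≡⟨ eval-S̃P φ (σ 1 (n ∷ ns)) ⟩
  eval φ̃ (σ 1 (n ∷ ns))
    ≡⟨ eval-σ₁-fromZ φ̃ (n ∷ ns) w refl ⟩
  eval (λ s → φ̃ (parseY 0 s)) (sh w (x ∷ []))
    ≡⟨ eval-cong (sh w (x ∷ [])) (nilSupported-parseY {φ̃} (nilSupported-S̃ {φ} φ₀) 0) ⟩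
  eval (λ _ → 0ℚ) (sh w (x ∷ []))
    ≡⟨ eval-zero (sh w (x ∷ [])) ⟩
  0ℚ ∎
  where
  w = replicate n x ++ fromZ ns
  φ̃ = λ t → eval φ (S̃ t)

eval-ψ-sum-nilSupported : {h : ZWord → ℚ} → NilSupported h → ∀ w i → eval h (ψ-sum w i) ≡ 0ℚ
eval-ψ-sum-nilSupported     h₀ w zero    = refl
eval-ψ-sum-nilSupported {h} h₀ w (suc i) = begin
  eval h (ψ-sum w i ++ stP (take i w) (S̃σ₁-suffix w i))
    ≡⟨ eval-++ h (ψ-sum w i) (stP (take i w) (S̃σ₁-suffix w i)) ⟩
  eval h (ψ-sum w i) + eval h (stP (take i w) (S̃σ₁-suffix w i))
    ≡⟨ cong₂ _+_ (eval-ψ-sum-nilSupported {h} h₀ w i) (eval-stP h (take i w) (S̃σ₁-suffix w i)) ⟩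
  0ℚ + eval (λ t → eval h (st (take i w) t)) (S̃σ₁-suffix w i)
    ≡⟨ cong (0ℚ +_) (eval-S̃σ₁-nilSupported {φ = λ t → eval h (st (take i w) t)}
                       (eval-st-nonemptyʳ {h} h₀ (take i w)) (reverse (drop i w))) ⟩
  0ℚ ∎

δ : ZWord → ZWord → ℚ
δ v t = if does (List.≡-dec ℕ._≟_ t v) then 1ℚ else 0ℚ

coeff-eval : ∀ P v → coeff P v ≡ eval (δ v) P
coeff-eval []            v = refl
coeff-eval ((c , w) ∷ P) v with List.≡-dec ℕ._≟_ w v
... | yes _ = cong₂ _+_ (sym (ℚ.*-identityʳ c)) (coeff-eval P v)
... | no  _ = begin
  coeff P v                 ≡⟨ coeff-eval P v ⟩
  eval (δ v) P              ≡⟨ ℚ.+-identityˡ _ ⟨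
  0ℚ + eval (δ v) P         ≡⟨ cong (_+ eval (δ v) P) (ℚ.*-zeroʳ c) ⟨
  c * 0ℚ + eval (δ v) P     ∎

δ-∷ʳ-z₁ : ∀ u t → δ (u ∷ʳ 0) t ≡ ρᶻ (δ u) t
δ-∷ʳ-z₁ u t with reverseView t
... | [] with List.≡-dec ℕ._≟_ [] (u ∷ʳ 0)
...   | yes []≡ = ⊥-elim (case (List.++-conicalʳ u (0 ∷ []) (sym []≡)))
  where case : 0 ∷ [] ≢ []
        case ()
...   | no  _   = refl
δ-∷ʳ-z₁ u t | t′ ∶ _ ∶ʳ k = trans (compare-last k) (sym (ρ-∷ʳ isZ₁ (δ u) t′ k))
  where
  compare-last : ∀ k → δ (u ∷ʳ 0) (t′ ∷ʳ k) ≡ (if isZ₁ k then δ u t′ else 0ℚ)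
  compare-last k with List.≡-dec ℕ._≟_ (t′ ∷ʳ k) (u ∷ʳ 0) | List.≡-dec ℕ._≟_ t′ u
  ... | yes eq | yes _  rewrite List.∷ʳ-injectiveʳ t′ u eq = refl
  ... | yes eq | no  ne = ⊥-elim (ne (List.∷ʳ-injectiveˡ t′ u eq))
  ... | no  ne | yes refl with k
  ...   | zero  = ⊥-elim (ne refl)
  ...   | suc _ = refl
  compare-last k | no _ | no _ with isZ₁ k
  ...   | true  = refl
  ...   | false = refl

eval-ψP : (h : ZWord → ℚ) → (∀ w → eval h (ψ w) ≡ 0ℚ) → ∀ p → eval h (ψP p) ≡ 0ℚ
eval-ψP h ψ-vanishes p = begin
  eval h (ψP p)                           ≡⟨ eval-concatMap h (λ w → ψ (proj₁ w ∷ proj₂ w)) _ (λ _ _ → refl) p ⟩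
  eval (λ w → eval h (ψ (proj₁ w ∷ proj₂ w))) p ≡⟨ eval-cong p (λ w → ψ-vanishes (proj₁ w ∷ proj₂ w)) ⟩
  eval (λ _ → 0ℚ) p                       ≡⟨ eval-zero p ⟩
  0ℚ                                      ∎

inYHx-∷ʳ-suc : ∀ u j → InYHx (fromZ (u ∷ʳ suc j))
inYHx-∷ʳ-suc []      j = replicate j x , cong (y ∷_) (sym (xⁿ-++-x∷ j []))
inYHx-∷ʳ-suc (n ∷ u) j with inYHx-∷ʳ-suc u j
... | w , fromZ≡ = replicate n x ++ y ∷ w , (begin
  y ∷ (replicate n x ++ fromZ (u ∷ʳ suc j))   ≡⟨ cong (λ r → y ∷ (replicate n x ++ r)) fromZ≡ ⟩
  y ∷ (replicate n x ++ y ∷ (w ∷ʳ x))         ≡⟨ cong (y ∷_) (List.++-assoc (replicate n x) (y ∷ w) (x ∷ [])) ⟨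
  y ∷ ((replicate n x ++ y ∷ w) ∷ʳ x)         ∎)

lemma6 : (p : List (ℚ × ℕ × ZWord)) (v : ZWord) →
         coeff (ψP p) v ≢ 0ℚ → InYHx (fromZ v)
lemma6 p v coeff≢0 with reverseView v
... | [] = ⊥-elim (coeff≢0 (begin
  coeff (ψP p) []       ≡⟨ coeff-eval (ψP p) [] ⟩
  eval (δ []) (ψP p)    ≡⟨ eval-ψP (δ []) (λ w → eval-ψ-sum-nilSupported {δ []} (λ _ _ → refl) w (length w)) p ⟩
  0ℚ                    ∎))
... | u ∶ _ ∶ʳ zero = ⊥-elim (coeff≢0 (begin
  coeff (ψP p) (u ∷ʳ 0)      ≡⟨ coeff-eval (ψP p) (u ∷ʳ 0) ⟩
  eval (δ (u ∷ʳ 0)) (ψP p)   ≡⟨ eval-cong (ψP p) (δ-∷ʳ-z₁ u) ⟩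
  eval (ρᶻ (δ u)) (ψP p)     ≡⟨ eval-ψP (ρᶻ (δ u)) (ρᶻ-ψ (δ u)) p ⟩
  0ℚ                         ∎))
... | u ∶ _ ∶ʳ suc j = inYHx-∷ʳ-suc u j
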